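{- We have the inclusion of subspaces of $\mathfrak{Lie}(X)$ \[ \mathfrak{stab}_{\mathfrak{Lie}(X)}(\Delta_Y)\subset\{\psi\in\mathfrak{Lie}(X)\mid\pi_Y(\psi)\in\mathfrak{Lie}(Y)\}. \]
   Context: $\mathbb{Q}\langle X\rangle$ is the free associative $\mathbb{Q}$-algebra on $X=\{x_0,x_1\}$ and $\mathfrak{Lie}(X)\subset\mathbb{Q}\langle X\rangle$ the free Lie algebra on $X$. $\mathbb{Q}\langle Y\rangle$ is the free associative algebra on $Y=\{y_1,y_2,\dots\}$, with coproduct $\Delta_Y$ the algebra morphism with $\Delta_Y(y_n)=y_n\otimes1+1\otimes y_n$, and $\mathfrak{Lie}(Y)$ its set of $\Delta_Y$-primitive elements. Identify $\mathbb{Q}\langle Y\rangle$ with a subalgebra of $\mathbb{Q}\langle X\rangle$ via $y_n\mapsto x_0^{n-1}x_1$; $\pi_Y:\mathbb{Q}\langle X\rangle\to\mathbb{Q}\langle Y\rangle$ sends $x_0^{k_1-1}x_1\cdots x_0^{k_d-1}x_1x_0^r$ to $y_{k_1}\cdots y_{k_d}$ if $r=0$ and to $0$ otherwise. For $\psi\in\mathbb{Q}\langle X\rangle$ let $d_\psi$ be the derivation with $d_\psi(x_0)=0$, $d_\psi(x_1)=[x_1,\psi]$; for $\psi\in\mathfrak{Lie}(X)$, $s_\psi=\ell_\psi+d_\psi$ ($\ell_\psi$ left multiplication) preserves $\mathbb{Q}\langle X\rangle x_0$, and $s^Y_\psi$ is the unique linear endomorphism of $\mathbb{Q}\langle Y\rangle$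 with $\pi_Y\circ s_\psi=s^Y_\psi\circ\pi_Y$. $\mathfrak{stab}_{\mathfrak{Lie}(X)}(\Delta_Y)=\{\psi\in\mathfrak{Lie}(X)\mid(s^Y_\psi\otimes\mathrm{id}+\mathrm{id}\otimes s^Y_\psi)\circ\Delta_Y=\Delta_Y\circ s^Y_\psi\}$. -}

module Defs where

open import Data.Rational using (ℚ; 0ℚ; 1ℚ; _+_; _*_; -_)
open import Data.Nat as ℕ using (ℕ; zero; suc)
open import Data.List using (List; []; _∷_; _++_; map; concatMap; replicate)
open import Data.Product using (Σ; _×_; _,_; ∃)
open import Data.Maybe using (Maybe; just; nothing)
open import Data.Bool using (if_then_else_)
open import Relation.Nullary using (yes; no; does)
open import Relation.Binary.PropositionalEquality using (_≡_; refl)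
open import Relation.Binary.Definitions using (DecidableEquality)
import Data.List.Properties as LP
import Data.Product.Properties as PP

-- Formal finite ℚ-linear combinations of basis elements of type A.
-- An element is a list of (coefficient, basis element) pairs; two
-- elements are equal when all their coefficients agree.

Poly : Set → Set
Poly A = List (ℚ × A)

coeff : {A : Set} → DecidableEquality A → Poly A → A → ℚ
coeff _≟_ [] w = 0ℚ
coeff _≟_ ((c , u) ∷ p) w = (if does (u ≟ w) then c else 0ℚ) + coeff _≟_ p w

zeroP : {A : Set} → Poly A
zeroP = []

single : {A : Set} → A → Poly A
single w = (1ℚ , w) ∷ []

_⊕_ : {A : Set} → Poly A → Poly A → Poly A
p ⊕ q = p ++ q

scale : {A : Set} → ℚ → Poly A → Poly A
scale c p = map (λ { (a , w) → (c * a , w) }) p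

negP : {A : Set} → Poly A → Poly A
negP = scale (- 1ℚ)

_⊖_ : {A : Set} → Poly A → Poly A → Poly A
p ⊖ q = p ⊕ negP q

lin : {A B : Set} → (A → Poly B) → Poly A → Poly B
lin f p = concatMap (λ { (a , w) → scale a (f w) }) p

data X : Set where
  x₀ x₁ : X

_≟X_ : DecidableEquality X
x₀ ≟X x₀ = yes refl
x₀ ≟X x₁ = no λ ()
x₁ ≟X x₀ = no λ ()
x₁ ≟X x₁ = yes refl

WX : Set
WX = List X

-- The letter k : ℕ of a Y-word stands for y_(k+1) (so Y = {y₁,y₂,…}).
WY : Set
WY = List ℕ

decWX : DecidableEquality WX
decWX = LP.≡-dec _≟X_

decWY : DecidableEquality WY
decWY = LP.≡-dec ℕ._≟_

decWY² : DecidableEquality (WY × WY)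
decWY² = PP.≡-dec decWY decWY

QX QY QY⊗QY : Set
QX = Poly WX
QY = Poly WY
QY⊗QY = Poly (WY × WY)

_≈X_ : QX → QX → Set
p ≈X q = ∀ w → coeff decWX p w ≡ coeff decWX q w

_≈Y_ : QY → QY → Set
p ≈Y q = ∀ w → coeff decWY p w ≡ coeff decWY q w

_≈T_ : QY⊗QY → QY⊗QY → Set
p ≈T q = ∀ w → coeff decWY² p w ≡ coeff decWY² q w

_·X_ : QX → QX → QX
p ·X q = concatMap (λ { (a , u) → map (λ { (b , v) → (a * b , u ++ v) }) q }) p

⟦_,_⟧ : QX → QX → QX
⟦ p , q ⟧ = (p ·X q) ⊖ (q ·X p)

letter : X → QX
letter a = single (a ∷ [])

-- The free Lie algebra Lie(X) ⊂ ℚ⟨X⟩: the ℚ-span of iterated brackets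
-- of the generators x₀, x₁ (the Lie subalgebra generated by X).

data LieTerm : Set where
  gen : X → LieTerm
  br  : LieTerm → LieTerm → LieTerm

evalLT : LieTerm → QX
evalLT (gen a)  = letter a
evalLT (br s t) = ⟦ evalLT s , evalLT t ⟧

IsLieX : QX → Set
IsLieX ψ = Σ (Poly LieTerm) λ c → lin evalLT c ≈X ψ

dLetter : QX → X → QX
dLetter ψ x₀ = zeroP
dLetter ψ x₁ = ⟦ letter x₁ , ψ ⟧

dWord : QX → WX → QX
dWord ψ []      = zeroP
dWord ψ (a ∷ w) = (dLetter ψ a ·X single w) ⊕ (letter a ·X dWord ψ w)

d : QX → QX → QX
d ψ = lin (dWord ψ)

s : QX → QX → QX
s ψ p = (ψ ·X p) ⊕ d ψ p

ιW : WY → WX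
ιW []      = []
ιW (k ∷ v) = replicate k x₀ ++ (x₁ ∷ ιW v)

ι : QY → QX
ι = lin (λ v → single (ιW v))

-- parse x₀^(k₁-1)x₁ ⋯ x₀^(k_d-1)x₁ x₀^r; k counts pending x₀'s
parse : ℕ → WX → Maybe WY
parse zero    []       = just []
parse (suc k) []       = nothing
parse k       (x₀ ∷ w) = parse (suc k) w
parse k       (x₁ ∷ w) = Data.Maybe.map (k ∷_) (parse zero w)

πYW : WX → QY
πYW w with parse zero w
... | just v  = single v
... | nothing = zeroP

πY : QX → QY
πY = lin πYW

-- s^Y_ψ : the linear endomorphism of ℚ⟨Y⟩ with π_Y ∘ s_ψ = s^Y_ψ ∘ π_Y.
-- Since π_Y ∘ ι = id on ℚ⟨Y⟩, it is given by s^Y_ψ = π_Y ∘ s_ψ ∘ ι.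
sY : QX → QY → QY
sY ψ p = πY (s ψ (ι p))

_·T_ : QY⊗QY → QY⊗QY → QY⊗QY
p ·T q = concatMap (λ { (a , (u , u')) →
           map (λ { (b , (v , v')) → (a * b , (u ++ v , u' ++ v')) }) q }) p

ΔW : WY → QY⊗QY
ΔW []      = single ([] , [])
ΔW (k ∷ v) = (single (k ∷ [] , []) ⊕ single ([] , k ∷ [])) ·T ΔW v

ΔY : QY → QY⊗QY
ΔY = lin ΔW

_⊗id : (QY → QY) → QY⊗QY → QY⊗QY
(f ⊗id) = lin (λ { (u , u') → map (λ { (a , v) → (a , (v , u')) }) (f (single u)) })

id⊗_ : (QY → QY) → QY⊗QY → QY⊗QY
(id⊗ f) = lin (λ { (u , u') → map (λ { (a , v) → (a , (u , v)) }) (f (single u')) })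

IsLieY : QY → Set
IsLieY p = ΔY p ≈T (map (λ { (a , u) → (a , (u , [])) }) p ⊕ map (λ { (a , u) → (a , ([] , u)) }) p)

InStab : QX → Set
InStab ψ = IsLieX ψ × (∀ (p : QY) → ((sY ψ ⊗id) (ΔY p) ⊕ (id⊗ sY ψ) (ΔY p)) ≈T ΔY (sY ψ p))

{-# OPTIONS --safe #-}
module Submission where

open import Defs
open import Data.Product using (_×_; _,_)
open import Data.List using ([]; _∷_; _++_; map)
open import Data.List.Properties using (++-identityʳ; map-cong)
open import Data.Rational using (ℚ; 1ℚ)
open import Data.Rational.Properties using (*-identityˡ; *-identityʳ)
open import Relation.Binary.PropositionalEquality

-- The stability condition at p = 1 reads s^Y_ψ(1) ⊗ 1 + 1 ⊗ s^Y_ψ(1) = Δ_Y(s^Y_ψ(1)),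
-- and s^Y_ψ(1) = π_Y(ψ · 1 + d_ψ(1)) = π_Y(ψ) because the derivation d_ψ kills 1.

·X-identityʳ : (p : QX) → p ·X single [] ≡ p
·X-identityʳ []            = refl
·X-identityʳ ((a , u) ∷ p) = cong₂ _∷_ (cong₂ _,_ (*-identityʳ a) (++-identityʳ u)) (·X-identityʳ p)

scale-identity : {A : Set} (p : Poly A) → scale 1ℚ p ≡ p
scale-identity []            = refl
scale-identity ((a , u) ∷ p) = cong₂ _∷_ (cong₂ _,_ (*-identityˡ a) refl) (scale-identity p)

s-one : (ψ : QX) → s ψ (single []) ≡ ψ
s-one ψ = trans (++-identityʳ (ψ ·X single [])) (·X-identityʳ ψ)

sY-one : (ψ : QX) → sY ψ (single []) ≡ πY ψ
sY-one ψ = cong πY (s-one ψ)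

-- The maps g are abstracted because the pattern lambdas of ⊗id, id⊗ and IsLieY
-- are distinct terms that agree only pointwise.
⊗id-ΔY-one : (f : QY → QY) (g : ℚ × WY → ℚ × (WY × WY)) → (∀ a u → (a , (u , [])) ≡ g (a , u)) →
  (f ⊗id) (ΔY (single [])) ≡ map g (f (single []))
⊗id-ΔY-one f g g-left =
  trans (++-identityʳ _) (trans (scale-identity _) (map-cong (λ { (a , u) → g-left a u }) _))

id⊗-ΔY-one : (f : QY → QY) (g : ℚ × WY → ℚ × (WY × WY)) → (∀ a u → (a , ([] , u)) ≡ g (a , u)) →
  (id⊗ f) (ΔY (single [])) ≡ map g (f (single []))
id⊗-ΔY-one f g g-right =
  trans (++-identityʳ _) (trans (scale-identity _) (map-cong (λ { (a , u) → g-right a u }) _))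

CoderivationAt : (QY → QY) → QY → Set
CoderivationAt f p = ((f ⊗id) (ΔY p) ⊕ (id⊗ f) (ΔY p)) ≈T ΔY (f p)

coderivationAt-one⇒primitive : (f : QY → QY) → CoderivationAt f (single []) → IsLieY (f (single []))
coderivationAt-one⇒primitive f coder w =
  trans (sym (coder w))
        (cong (λ t → coeff decWY² t w)
              (cong₂ _++_ (⊗id-ΔY-one f _ (λ _ _ → refl)) (id⊗-ΔY-one f _ (λ _ _ → refl))))

lemma1p15 : (ψ : QX) → InStab ψ → IsLieX ψ × IsLieY (πY ψ)
lemma1p15 ψ (lie , stable) =
  lie , subst IsLieY (sY-one ψ) (coderivationAt-one⇒primitive (sY ψ) (stable (single [])))
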